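{- Let $n\geqslant1$, $X\subseteq\mathbb{Z}_n\setminus\{0\}$, $Y\subseteq\mathbb{Z}_n$, let $\zeta_n$ be a primitive $n$-th root of unity, and define $\mathbf{r}(z)=\sum_{i\in X}\zeta_n^{iz}$ and $\mathbf{t}(z)=\sum_{i\in Y}\zeta_n^{iz}$ for $z\in\mathbb{Z}_n$. Then $Dih(n,X,Y)$ is a DSRG with parameters $(2n,|X|+|Y|,\mu,\lambda,t)$ if and only if for all $z\in\mathbb{Z}_n$: (i) $\mathbf{t}(z)\big(\mathbf{r}(z)+\overline{\mathbf{r}(z)}\big)=\mu n\,\delta_{z,0}+(\lambda-\mu)\mathbf{t}(z)$; (ii) $\mathbf{r}(z)^2+|\mathbf{t}(z)|^2=t-\mu+\mu n\,\delta_{z,0}+(\lambda-\mu)\mathbf{r}(z)$.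
   Context: $D_n=\langle x,a\mid x^n=1,\ a^2=1,\ ax=x^{ -1}a\rangle$; $Dih(n,X,Y)$ is the Cayley digraph on $D_n$ with connection set $\{x^i:i\in X\}\cup\{x^ja:j\in Y\}$. A DSRG with parameters $(N,k,\mu,\lambda,t)$: adjacency matrix $A$ with $AJ=JA=kJ$ and $A^2=tI+\lambda A+\mu(J-I-A)$. The bold functions $\mathbf{r},\mathbf{t}$ are distinct from the parameter $t$; $\delta_{z,0}$ is $1$ if $z=0$ and $0$ otherwise; the bar denotes complex conjugation. -}

module Defs where

open import Level using (Level; _⊔_)
open import Data.Bool using (Bool; true; false; if_then_else_; _xor_; _∧_)
open import Data.Nat as ℕ using (ℕ; zero; suc; NonZero; _∸_; _<_)
open import Data.Nat.DivMod using (_mod_)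
open import Data.Fin using (Fin; toℕ)
open import Data.Fin.Subset using (Subset)
open import Data.Vec using (lookup)
open import Data.List using (List; foldr; map; allFin; concatMap; length; _∷_; [])
open import Data.Product using (_×_; _,_)
open import Data.Sum using (_⊎_)
open import Data.Integer as ℤ using (ℤ; +_)
open import Relation.Binary.PropositionalEquality using (_≡_)
open import Relation.Nullary using (¬_; does)
import Data.Fin
import Data.Bool
open import Algebra.Bundles using (CommutativeRing; Semiring)
import Algebra.Definitions.RawSemiring as RS

module _ (n : ℕ) .{{_ : NonZero n}} where

  addₙ : Fin n → Fin n → Fin n
  addₙ i j = (toℕ i ℕ.+ toℕ j) mod n

  negₙ : Fin n → Fin n
  negₙ i = (n ∸ toℕ i) mod n

-- The element (i , b) stands for x^i a^b
-- (b = false : x^i ,  b = true : x^i a).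
-- Multiplication: x^i a^b · x^j a^c = x^(i + (-1)^b j) a^(b xor c),
-- using a x^j = x^(-j) a.

Dih : ℕ → Set
Dih n = Fin n × Bool

module _ (n : ℕ) .{{_ : NonZero n}} where

  dmul : Dih n → Dih n → Dih n
  dmul (i , false) (j , c) = (addₙ n i j , c)
  dmul (i , true)  (j , c) = (addₙ n i (negₙ n j) , c xor true)

  dinv : Dih n → Dih n
  dinv (i , false) = (negₙ n i , false)
  dinv (i , true)  = (i , true)

  dihElems : List (Dih n)
  dihElems = concatMap (λ i → (i , false) ∷ (i , true) ∷ []) (allFin n)

  inConn : Subset n → Subset n → Dih n → ℕ
  inConn X Y (i , false) = if lookup X i then 1 else 0
  inConn X Y (j , true)  = if lookup Y j then 1 else 0

  -- adjacency matrix of the Cayley digraph Dih(n,X,Y):  g → h  iff  g⁻¹h ∈ S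
  dihAdj : Subset n → Subset n → Dih n → Dih n → ℕ
  dihAdj X Y g h = inConn X Y (dmul (dinv g) h)

-- Directed strongly regular graphs, for a 0/1 adjacency matrix A on a
-- finite vertex type V enumerated (without repetition) by the list vs.

sumℕ : {V : Set} → List V → (V → ℕ) → ℕ
sumℕ vs f = foldr (λ v s → f v ℕ.+ s) 0 vs

δ : {V : Set} → (V → V → Bool) → V → V → ℕ
δ eq g h = if eq g h then 1 else 0

record IsDSRG {V : Set} (vs : List V) (_≟V_ : V → V → Bool)
              (A : V → V → ℕ) (N k μ lam t : ℕ) : Set where
  field
    vertexCount : length vs ≡ N
    rowSums     : ∀ g → sumℕ vs (λ h → A g h) ≡ k
    colSums     : ∀ h → sumℕ vs (λ g → A g h) ≡ k
    square      : ∀ g h →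
      (+ sumℕ vs (λ w → A g w ℕ.* A w h))
        ≡ (+ t) ℤ.* (+ δ _≟V_ g h) ℤ.+ (+ lam) ℤ.* (+ A g h)
          ℤ.+ (+ μ) ℤ.* ((+ 1) ℤ.- (+ δ _≟V_ g h) ℤ.- (+ A g h))


module _ (n : ℕ) .{{_ : NonZero n}} where

  eqFin : Fin n → Fin n → Bool
  eqFin i j = does (i Data.Fin.≟ j)

  eqDih : Dih n → Dih n → Bool
  eqDih (i , b) (j , c) = eqFin i j ∧ does (b Data.Bool.≟ c)

-- Ring side: an integral domain of characteristic 0 with a primitive
-- n-th root of unity ζ (abstracting the complex numbers).

module Cyclo {c ℓ : Level} (R : CommutativeRing c ℓ) where
  open CommutativeRing R
  open RS (Semiring.rawSemiring semiring) using (_^_) renaming (_×_ to _·ℕ_)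

  IsIntegralDomain : Set (c ⊔ ℓ)
  IsIntegralDomain = ∀ x y → x * y ≈ 0# → x ≈ 0# ⊎ y ≈ 0#

  CharZero : Set ℓ
  CharZero = ∀ m → m ·ℕ 1# ≈ 0# → m ≡ 0

  IsPrimitiveRoot : ℕ → Carrier → Set ℓ
  IsPrimitiveRoot n ζ = (ζ ^ n ≈ 1#) × (∀ k → 0 < k → k < n → ¬ (ζ ^ k ≈ 1#))

  ι : ℕ → Carrier
  ι m = m ·ℕ 1#

  sumOver : {n : ℕ} → Subset n → (Fin n → ℕ) → Carrier → Carrier
  sumOver {n} X e ζ = foldr (λ i s → (if lookup X i then ζ ^ e i else 0#) + s) 0# (allFin n)

  -- 𝐫(z) = Σ_{i∈X} ζ^{iz}, and its complex conjugate Σ_{i∈X} ζ^{-iz},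
  -- where ζ^{-m} = (ζ^{n-1})^m since ζ^n = 1.
  charSum : {n : ℕ} → Carrier → Subset n → Fin n → Carrier
  charSum ζ X z = sumOver X (λ i → toℕ i ℕ.* toℕ z) ζ

  charSumConj : {n : ℕ} → Carrier → Subset n → Fin n → Carrier
  charSumConj {n} ζ X z = sumOver X (λ i → (n ∸ 1) ℕ.* (toℕ i ℕ.* toℕ z)) ζ

  δ₀ : {n : ℕ} → Fin n → Carrier
  δ₀ z with toℕ z
  ... | zero = 1#
  ... | suc _ = 0#

-- Restrict both sides of A² = t I + λ A + μ (J - I - A) to the row of a vertex x^i a^b and to the
-- coset x^* a^c of targets: this gives functions on ℤ_n, and their Fourier transforms at z are
-- χ_z(i) times a 2×2 block expression M(z) in 𝐫(±z) and 𝐭(±z), the transform of the adjacency matrix.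
-- In characteristic 0 with ζ primitive, Σ_z ζ^(a z) = n δ_{a,0}, so the transform is injective and
-- the matrix identity is equivalent to the block identities for all b, c, z.  Conjugating by the
-- reflection a turns the blocks with b = true into those with b = false at -z, and the two blocks
-- with b = false are (i) and (ii) once the μ-terms are moved across.

module Submission where

open import Defs
open import Level using (Level)
open import Data.Bool as 𝔹 using (Bool; true; false; if_then_else_; _xor_; _∧_; not)
open import Data.Nat as ℕ using (ℕ; zero; suc; NonZero; _∸_; _%_; _/_)
import Data.Nat.Properties as ℕ
open import Data.Nat.DivMod using (_mod_; %-distribˡ-+; m%n%n≡m%n; m<n⇒m%n≡m; n%n≡0; m≡m%n+[m/n]*n)
import Data.Integer as ℤ
import Data.Integer.Properties as ℤ
open import Data.Integer.Tactic.RingSolver using (solve-∀)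
open import Data.Fin as F using (Fin; toℕ)
open import Data.Fin.Properties using (toℕ-injective; toℕ<n; toℕ≤n; toℕ-fromℕ<)
open import Data.Fin.Permutation using (permutation)
open import Data.Fin.Subset using (Subset; ∣_∣)
open import Data.List using (List; length; concatMap; foldr; tabulate; _∷_; [])
open import Data.Vec using (lookup; []; _∷_)
open import Data.Product using (_×_; _,_; proj₁; proj₂)
open import Data.Sum using (inj₁; inj₂)
open import Function.Bundles using (_⇔_; mk⇔; Equivalence)
open import Function.Properties.Equivalence using () renaming (trans to ⇔-trans)
open import Relation.Nullary using (¬_; yes; no; does; contradiction)
open import Relation.Binary.PropositionalEquality as ≡ using (_≡_; _≢_)
open import Algebra.Bundles using (AbelianGroup; CommutativeMonoid; CommutativeRing; Semiring)
import Algebra.Structures as Structures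
open import Algebra.Consequences.Propositional using (comm∧idˡ⇒id; comm∧invˡ⇒inv)
import Algebra.Definitions.RawSemiring as RawSemiringDefinitions
import Algebra.Properties.AbelianGroup as AbelianGroupProperties
import Algebra.Properties.CommutativeMonoid.Sum as MonoidSum

module ℤₙ (n : ℕ) .{{_ : NonZero n}} where
  open ≡ using (refl; sym; trans; cong; cong₂; isEquivalence; module ≡-Reasoning)

  infixl 6 _+ₙ_ _-ₙ_
  infix 8 -ₙ_

  _+ₙ_ : Fin n → Fin n → Fin n
  _+ₙ_ = addₙ n

  -ₙ_ : Fin n → Fin n
  -ₙ_ = negₙ n

  _-ₙ_ : Fin n → Fin n → Fin n
  a -ₙ b = a +ₙ -ₙ b

  0ₙ : Fin n
  0ₙ = 0 mod n

  toℕ-mod : ∀ m → toℕ (m mod n) ≡ m % n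
  toℕ-mod m = toℕ-fromℕ< _

  toℕ-0ₙ : toℕ 0ₙ ≡ 0
  toℕ-0ₙ = trans (toℕ-mod 0) (m<n⇒m%n≡m (ℕ.>-nonZero⁻¹ n))

  toℕ-+ₙ : ∀ a b → toℕ (a +ₙ b) ≡ (toℕ a ℕ.+ toℕ b) % n
  toℕ-+ₙ a b = toℕ-mod _

  mod-≡ : ∀ {x y} → x % n ≡ y % n → x mod n ≡ y mod n
  mod-≡ e = toℕ-injective (trans (toℕ-mod _) (trans e (sym (toℕ-mod _))))

  [m%n+k]%n≡[m+k]%n : ∀ m k → (m % n ℕ.+ k) % n ≡ (m ℕ.+ k) % n
  [m%n+k]%n≡[m+k]%n m k = begin
    (m % n ℕ.+ k) % n         ≡⟨ %-distribˡ-+ (m % n) k n ⟩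
    (m % n % n ℕ.+ k % n) % n ≡⟨ cong (λ u → (u ℕ.+ k % n) % n) (m%n%n≡m%n m n) ⟩
    (m % n ℕ.+ k % n) % n     ≡⟨ %-distribˡ-+ m k n ⟨
    (m ℕ.+ k) % n             ∎
    where open ≡-Reasoning

  [k+m%n]%n≡[k+m]%n : ∀ k m → (k ℕ.+ m % n) % n ≡ (k ℕ.+ m) % n
  [k+m%n]%n≡[k+m]%n k m = begin
    (k ℕ.+ m % n) % n ≡⟨ cong (_% n) (ℕ.+-comm k (m % n)) ⟩
    (m % n ℕ.+ k) % n ≡⟨ [m%n+k]%n≡[m+k]%n m k ⟩
    (m ℕ.+ k) % n     ≡⟨ cong (_% n) (ℕ.+-comm m k) ⟩
    (k ℕ.+ m) % n     ∎
    where open ≡-Reasoning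

  +ₙ-assoc : ∀ a b c → (a +ₙ b) +ₙ c ≡ a +ₙ (b +ₙ c)
  +ₙ-assoc a b c = mod-≡ (begin
    (toℕ (a +ₙ b) ℕ.+ toℕ c) % n             ≡⟨ cong (λ u → (u ℕ.+ toℕ c) % n) (toℕ-+ₙ a b) ⟩
    ((toℕ a ℕ.+ toℕ b) % n ℕ.+ toℕ c) % n    ≡⟨ [m%n+k]%n≡[m+k]%n _ (toℕ c) ⟩
    (toℕ a ℕ.+ toℕ b ℕ.+ toℕ c) % n          ≡⟨ cong (_% n) (ℕ.+-assoc (toℕ a) _ _) ⟩
    (toℕ a ℕ.+ (toℕ b ℕ.+ toℕ c)) % n        ≡⟨ [k+m%n]%n≡[k+m]%n (toℕ a) _ ⟨
    (toℕ a ℕ.+ (toℕ b ℕ.+ toℕ c) % n) % n    ≡⟨ cong (λ u → (toℕ a ℕ.+ u) % n) (toℕ-+ₙ b c) ⟨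
    (toℕ a ℕ.+ toℕ (b +ₙ c)) % n             ∎)
    where open ≡-Reasoning

  +ₙ-comm : ∀ a b → a +ₙ b ≡ b +ₙ a
  +ₙ-comm a b = cong (_mod n) (ℕ.+-comm (toℕ a) (toℕ b))

  +ₙ-identityˡ : ∀ a → 0ₙ +ₙ a ≡ a
  +ₙ-identityˡ a = toℕ-injective (begin
    toℕ (0ₙ +ₙ a)              ≡⟨ toℕ-+ₙ 0ₙ a ⟩
    (toℕ 0ₙ ℕ.+ toℕ a) % n     ≡⟨ cong (λ u → (u ℕ.+ toℕ a) % n) toℕ-0ₙ ⟩
    toℕ a % n                  ≡⟨ m<n⇒m%n≡m (toℕ<n a) ⟩
    toℕ a                      ∎)
    where open ≡-Reasoning

  -ₙ-inverseˡ : ∀ a → -ₙ a +ₙ a ≡ 0ₙ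
  -ₙ-inverseˡ a = mod-≡ (begin
    (toℕ (-ₙ a) ℕ.+ toℕ a) % n       ≡⟨ cong (λ u → (u ℕ.+ toℕ a) % n) (toℕ-mod (n ∸ toℕ a)) ⟩
    ((n ∸ toℕ a) % n ℕ.+ toℕ a) % n  ≡⟨ [m%n+k]%n≡[m+k]%n (n ∸ toℕ a) (toℕ a) ⟩
    (n ∸ toℕ a ℕ.+ toℕ a) % n        ≡⟨ cong (_% n) (ℕ.m∸n+n≡m (toℕ≤n a)) ⟩
    n % n                            ≡⟨ n%n≡0 n ⟩
    0                                ≡⟨ m<n⇒m%n≡m (ℕ.>-nonZero⁻¹ n) ⟨
    0 % n                            ∎)
    where open ≡-Reasoning

  +ₙ-isAbelianGroup : Structures.IsAbelianGroup _≡_ _+ₙ_ 0ₙ (negₙ n)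
  +ₙ-isAbelianGroup = record
    { isGroup = record
      { isMonoid = record
        { isSemigroup = record
          { isMagma = record { isEquivalence = isEquivalence ; ∙-cong = cong₂ _+ₙ_ }
          ; assoc = +ₙ-assoc
          }
        ; identity = comm∧idˡ⇒id +ₙ-comm +ₙ-identityˡ
        }
      ; inverse = comm∧invˡ⇒inv +ₙ-comm -ₙ-inverseˡ
      ; ⁻¹-cong = cong (negₙ n)
      }
    ; comm = +ₙ-comm
    }

  +ₙ-abelianGroup : AbelianGroup _ _
  +ₙ-abelianGroup = record { isAbelianGroup = +ₙ-isAbelianGroup }

  private
    module G = AbelianGroupProperties +ₙ-abelianGroup

  -ₙ+ₙ-cancelˡ : ∀ a m → -ₙ a +ₙ (a +ₙ m) ≡ m
  -ₙ+ₙ-cancelˡ = G.\\-leftDividesʳ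

  +ₙ-ₙ-cancelˡ : ∀ a m → a +ₙ (-ₙ a +ₙ m) ≡ m
  +ₙ-ₙ-cancelˡ = G.\\-leftDividesˡ

  -ₙ-involutive : ∀ a → -ₙ -ₙ a ≡ a
  -ₙ-involutive = G.⁻¹-involutive

  -ₙ-0ₙ : -ₙ 0ₙ ≡ 0ₙ
  -ₙ-0ₙ = G.ε⁻¹≈ε

  -ₙa+ₙm≡0ₙ⇒m≡a : ∀ a m → -ₙ a +ₙ m ≡ 0ₙ → m ≡ a
  -ₙa+ₙm≡0ₙ⇒m≡a a m e = trans (G.inverseʳ-unique (-ₙ a) m e) (-ₙ-involutive a)

  -ₙ-reflection-involutive : ∀ a m → a -ₙ (a -ₙ m) ≡ m
  -ₙ-reflection-involutive a m =
    trans (cong (a +ₙ_) (G.⁻¹-anti-homo‿- a m)) (trans (sym (+ₙ-assoc a m (-ₙ a))) (G.xyx⁻¹≈y a m))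

module ℤₙ-Sums {c ℓ} (M : CommutativeMonoid c ℓ) (n : ℕ) .{{_ : NonZero n}} where
  open CommutativeMonoid M
  open MonoidSum M using (sum; ∑-permute)
  open ℤₙ n

  ∑-translate : ∀ a (f : Fin n → Carrier) → sum (λ x → f (a +ₙ x)) ≈ sum f
  ∑-translate a f = sym (∑-permute f (permutation (a +ₙ_) (-ₙ a +ₙ_) (+ₙ-ₙ-cancelˡ a) (-ₙ+ₙ-cancelˡ a)))

  ∑-reflect : ∀ a (f : Fin n → Carrier) → sum (λ x → f (a -ₙ x)) ≈ sum f
  ∑-reflect a f = sym (∑-permute f (permutation reflect reflect (-ₙ-reflection-involutive a) (-ₙ-reflection-involutive a)))
    where reflect = λ x → a -ₙ x

module ℕΣ = MonoidSum ℕ.+-0-commutativeMonoid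

_≟ᶠ_ : ∀ {k} → Fin k → Fin k → Bool
i ≟ᶠ j = does (i F.≟ j)

module RingProperties {c ℓ} (R : CommutativeRing c ℓ) where
  open CommutativeRing R
  open Cyclo R using (ι; CharZero)
  open import Algebra.Properties.Semiring.Sum semiring using (sum; *-distribˡ-sum)
  open import Algebra.Properties.Monoid.Mult +-monoid using (×-homo-+)
  open import Algebra.Properties.Semiring.Mult semiring using (×1-homo-*)
  open import Algebra.Properties.Group +-group using (∙-cancelʳ)
  open import Algebra.Properties.CommutativeSemigroup *-commutativeSemigroup using (x∙yz≈y∙xz)
  open import Algebra.Solver.Ring.NaturalCoefficients.Default commutativeSemiring using (solve; _:*_; _:+_; _:=_)
  open import Relation.Binary.Reasoning.Setoid setoid

  ι-+ : ∀ a b → ι (a ℕ.+ b) ≈ ι a + ι b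
  ι-+ a b = ×-homo-+ 1# a b

  ι-* : ∀ a b → ι (a ℕ.* b) ≈ ι a * ι b
  ι-* = ×1-homo-*

  ι-1 : ι 1 ≈ 1#
  ι-1 = +-identityʳ 1#

  ι-sum : ∀ {k} (f : Fin k → ℕ) → ι (ℕΣ.sum f) ≈ sum (λ i → ι (f i))
  ι-sum {zero} f = refl
  ι-sum {suc k} f = trans (ι-+ (f F.zero) _) (+-congˡ (ι-sum (λ i → f (F.suc i))))

  ι-injective-≥ : CharZero → ∀ {a b} → b ℕ.≤ a → ι a ≈ ι b → a ≡ b
  ι-injective-≥ ch0 {a} {b} b≤a ιa≈ιb =
    ≡.trans (≡.sym (ℕ.m∸n+n≡m b≤a)) (≡.cong (ℕ._+ b) (ch0 (a ∸ b) ι[a∸b]≈0))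
    where
    ι[a∸b]≈0 : ι (a ∸ b) ≈ 0#
    ι[a∸b]≈0 = ∙-cancelʳ (ι b) _ _ (begin
      ι (a ∸ b) + ι b   ≈⟨ ι-+ (a ∸ b) b ⟨
      ι (a ∸ b ℕ.+ b)   ≡⟨ ≡.cong ι (ℕ.m∸n+n≡m b≤a) ⟩
      ι a               ≈⟨ ιa≈ιb ⟩
      ι b               ≈⟨ +-identityˡ (ι b) ⟨
      0# + ι b          ∎)

  ι-injective : CharZero → ∀ {a b} → ι a ≈ ι b → a ≡ b
  ι-injective ch0 {a} {b} ιa≈ιb with ℕ.≤-total a b
  ... | inj₁ a≤b = ≡.sym (ι-injective-≥ ch0 a≤b (sym ιa≈ιb))
  ... | inj₂ b≤a = ι-injective-≥ ch0 b≤a ιa≈ιb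

  ∑-select : ∀ {k} (i : Fin k) (f : Fin k → Carrier) → sum (λ j → ι (δ _≟ᶠ_ i j) * f j) ≈ f i
  ∑-select {suc k} F.zero f = begin
    ι 1 * f F.zero + sum (λ j → 0# * f (F.suc j))
      ≈⟨ +-cong (*-congʳ ι-1) (sym (*-distribˡ-sum {k} 0# (λ j → f (F.suc j)))) ⟩
    1# * f F.zero + 0# * sum (λ j → f (F.suc j))   ≈⟨ +-cong (*-identityˡ _) (zeroˡ _) ⟩
    f F.zero + 0#                                  ≈⟨ +-identityʳ _ ⟩
    f F.zero                                       ∎
  ∑-select {suc k} (F.suc i) f = begin
    0# * f F.zero + sum (λ j → ι (δ _≟ᶠ_ i j) * f (F.suc j))  ≈⟨ +-cong (zeroˡ _) (∑-select i (λ j → f (F.suc j))) ⟩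
    0# + f (F.suc i)                                           ≈⟨ +-identityˡ _ ⟩
    f (F.suc i)                                                ∎

  inverse-unique : ∀ {a b c} → b * a ≈ 1# → c * a ≈ 1# → b ≈ c
  inverse-unique {a} {b} {c} ba≈1 ca≈1 = begin
    b              ≈⟨ *-identityʳ b ⟨
    b * 1#         ≈⟨ *-congˡ ca≈1 ⟨
    b * (c * a)    ≈⟨ x∙yz≈y∙xz b c a ⟩
    c * (b * a)    ≈⟨ *-congˡ ba≈1 ⟩
    c * 1#         ≈⟨ *-identityʳ c ⟩
    c              ∎

  foldr-tabulate : ∀ {A : Set} {m} (g : Fin m → A) (h : A → Carrier) →
                   foldr (λ a s → h a + s) 0# (tabulate g) ≡ sum (λ k → h (g k))
  foldr-tabulate {m = zero} g h = ≡.refl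
  foldr-tabulate {m = suc m} g h = ≡.cong (h (g F.zero) +_) (foldr-tabulate (λ k → g (F.suc k)) h)

  if-then-0≈ι-indicator : ∀ b x → (if b then x else 0#) ≈ ι (if b then 1 else 0) * x
  if-then-0≈ι-indicator true x = sym (trans (*-congʳ ι-1) (*-identityˡ x))
  if-then-0≈ι-indicator false x = sym (zeroˡ x)

  +-cancelʳ-⇔ : ∀ {x x′ y y′ w} → x ≈ x′ + w → y ≈ y′ + w → (x ≈ y) ⇔ (x′ ≈ y′)
  +-cancelʳ-⇔ {x} {x′} {y} {y′} {w} x≈x′+w y≈y′+w = mk⇔
    (λ x≈y → ∙-cancelʳ w x′ y′ (trans (sym x≈x′+w) (trans x≈y y≈y′+w)))
    (λ x′≈y′ → trans x≈x′+w (trans (+-congʳ x′≈y′) (sym y≈y′+w)))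

  [a-b]x+bx≈ax : ∀ a b x → (a - b) * x + b * x ≈ a * x
  [a-b]x+bx≈ax a b x = begin
    (a - b) * x + b * x
      ≈⟨ solve 4 (λ a nb b x → (a :+ nb) :* x :+ b :* x := a :* x :+ (nb :+ b) :* x) refl a (- b) b x ⟩
    a * x + (- b + b) * x  ≈⟨ +-congˡ (trans (*-congʳ (-‿inverseˡ b)) (zeroˡ x)) ⟩
    a * x + 0#             ≈⟨ +-identityʳ _ ⟩
    a * x                  ∎

module Fourier {c ℓ} (R : CommutativeRing c ℓ) (dom : Cyclo.IsIntegralDomain R)
               (n : ℕ) .{{_ : NonZero n}}
               (ζ : CommutativeRing.Carrier R) (ζ-primitive : Cyclo.IsPrimitiveRoot R n ζ) where
  open CommutativeRing R
  open Cyclo R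
  open RawSemiringDefinitions (Semiring.rawSemiring semiring) using (_^_)
  open import Algebra.Properties.Semiring.Exp semiring using (^-homo-*; ^-assocʳ; ^-congˡ)
  open import Algebra.Properties.Semiring.Sum semiring
    using (sum; ∑-comm; ∑-distrib-+; *-distribˡ-sum; *-distribʳ-sum; sum-cong-≋; sum-replicate)
  open import Algebra.Properties.Ring ring using ([y-z]x≈yx-zx)
  open import Algebra.Properties.Group +-group using (∙-cancelʳ; x∙y⁻¹≈ε⇒x≈y)
  open import Algebra.Properties.CommutativeSemigroup *-commutativeSemigroup using (x∙yz≈y∙xz)
  open import Relation.Binary.Reasoning.Setoid setoid
  open import Algebra.Solver.Ring.NaturalCoefficients.Default commutativeSemiring using (solve; _:*_; _:+_; _:=_)
  open RingProperties R
  open ℤₙ n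
  open ℤₙ-Sums +-commutativeMonoid n

  ζ^[q*n]≈1 : ∀ q → ζ ^ (q ℕ.* n) ≈ 1#
  ζ^[q*n]≈1 zero = refl
  ζ^[q*n]≈1 (suc q) = begin
    ζ ^ (n ℕ.+ q ℕ.* n)         ≈⟨ ^-homo-* ζ n (q ℕ.* n) ⟩
    ζ ^ n * ζ ^ (q ℕ.* n)       ≈⟨ *-cong (proj₁ ζ-primitive) (ζ^[q*n]≈1 q) ⟩
    1# * 1#                     ≈⟨ *-identityˡ 1# ⟩
    1#                          ∎

  ζ^[m%n]≈ζ^m : ∀ m → ζ ^ (m % n) ≈ ζ ^ m
  ζ^[m%n]≈ζ^m m = sym (begin
    ζ ^ m                              ≡⟨ ≡.cong (ζ ^_) (m≡m%n+[m/n]*n m n) ⟩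
    ζ ^ (m % n ℕ.+ m / n ℕ.* n)        ≈⟨ ^-homo-* ζ (m % n) _ ⟩
    ζ ^ (m % n) * ζ ^ (m / n ℕ.* n)    ≈⟨ *-congˡ (ζ^[q*n]≈1 (m / n)) ⟩
    ζ ^ (m % n) * 1#                   ≈⟨ *-identityʳ _ ⟩
    ζ ^ (m % n)                        ∎)

  ζ^[m%n*k]≈ζ^[m*k] : ∀ m k → ζ ^ (m % n ℕ.* k) ≈ ζ ^ (m ℕ.* k)
  ζ^[m%n*k]≈ζ^[m*k] m k = begin
    ζ ^ (m % n ℕ.* k)   ≈⟨ ^-assocʳ ζ (m % n) k ⟨
    (ζ ^ (m % n)) ^ k   ≈⟨ ^-congˡ k (ζ^[m%n]≈ζ^m m) ⟩
    (ζ ^ m) ^ k         ≈⟨ ^-assocʳ ζ m k ⟩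
    ζ ^ (m ℕ.* k)       ∎

  ζ^[[n∸m]*k]*ζ^[m*k]≈1 : ∀ {m} k → m ℕ.≤ n → ζ ^ ((n ∸ m) ℕ.* k) * ζ ^ (m ℕ.* k) ≈ 1#
  ζ^[[n∸m]*k]*ζ^[m*k]≈1 {m} k m≤n = begin
    ζ ^ ((n ∸ m) ℕ.* k) * ζ ^ (m ℕ.* k)   ≈⟨ ^-homo-* ζ ((n ∸ m) ℕ.* k) (m ℕ.* k) ⟨
    ζ ^ ((n ∸ m) ℕ.* k ℕ.+ m ℕ.* k)       ≡⟨ ≡.cong (ζ ^_) (ℕ.*-distribʳ-+ k (n ∸ m) m) ⟨
    ζ ^ ((n ∸ m ℕ.+ m) ℕ.* k)             ≡⟨ ≡.cong (λ e → ζ ^ (e ℕ.* k)) (ℕ.m∸n+n≡m m≤n) ⟩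
    ζ ^ (n ℕ.* k)                         ≡⟨ ≡.cong (ζ ^_) (ℕ.*-comm n k) ⟩
    ζ ^ (k ℕ.* n)                         ≈⟨ ζ^[q*n]≈1 k ⟩
    1#                                    ∎

  χ : Fin n → Fin n → Carrier
  χ z a = ζ ^ (toℕ a ℕ.* toℕ z)

  χ-comm : ∀ z a → χ z a ≈ χ a z
  χ-comm z a = reflexive (≡.cong (ζ ^_) (ℕ.*-comm (toℕ a) (toℕ z)))

  χ-0ₙ : ∀ z → χ z 0ₙ ≈ 1#
  χ-0ₙ z = reflexive (≡.cong (λ e → ζ ^ (e ℕ.* toℕ z)) toℕ-0ₙ)

  χ-+ₙ : ∀ z a b → χ z (a +ₙ b) ≈ χ z a * χ z b
  χ-+ₙ z a b = begin
    ζ ^ (toℕ (a +ₙ b) ℕ.* toℕ z)                ≡⟨ ≡.cong (λ e → ζ ^ (e ℕ.* toℕ z)) (toℕ-+ₙ a b) ⟩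
    ζ ^ ((toℕ a ℕ.+ toℕ b) % n ℕ.* toℕ z)       ≈⟨ ζ^[m%n*k]≈ζ^[m*k] _ _ ⟩
    ζ ^ ((toℕ a ℕ.+ toℕ b) ℕ.* toℕ z)           ≡⟨ ≡.cong (ζ ^_) (ℕ.*-distribʳ-+ (toℕ z) (toℕ a) (toℕ b)) ⟩
    ζ ^ (toℕ a ℕ.* toℕ z ℕ.+ toℕ b ℕ.* toℕ z)   ≈⟨ ^-homo-* ζ (toℕ a ℕ.* toℕ z) _ ⟩
    χ z a * χ z b                               ∎

  χ-ₙ-inverse : ∀ z a → χ z (-ₙ a) * χ z a ≈ 1#
  χ-ₙ-inverse z a = begin
    ζ ^ (toℕ (-ₙ a) ℕ.* toℕ z) * χ z a         ≡⟨ ≡.cong (λ e → ζ ^ (e ℕ.* toℕ z) * χ z a) (toℕ-mod (n ∸ toℕ a)) ⟩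
    ζ ^ ((n ∸ toℕ a) % n ℕ.* toℕ z) * χ z a    ≈⟨ *-congʳ (ζ^[m%n*k]≈ζ^[m*k] _ _) ⟩
    ζ ^ ((n ∸ toℕ a) ℕ.* toℕ z) * χ z a        ≈⟨ ζ^[[n∸m]*k]*ζ^[m*k]≈1 (toℕ z) (toℕ≤n a) ⟩
    1#                                         ∎

  χ-ₙ : ∀ z a → χ z (-ₙ a) ≈ χ (-ₙ z) a
  χ-ₙ z a = inverse-unique (χ-ₙ-inverse z a)
    (trans (*-cong (χ-comm (-ₙ z) a) (χ-comm z a)) (χ-ₙ-inverse a z))

  ζ^[[n∸1]*[a*z]]≈χ[-z]a : ∀ z a → ζ ^ ((n ∸ 1) ℕ.* (toℕ a ℕ.* toℕ z)) ≈ χ (-ₙ z) a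
  ζ^[[n∸1]*[a*z]]≈χ[-z]a z a = trans (inverse-unique inverse (χ-ₙ-inverse z a)) (χ-ₙ z a)
    where
    inverse : ζ ^ ((n ∸ 1) ℕ.* (toℕ a ℕ.* toℕ z)) * χ z a ≈ 1#
    inverse = trans (*-congˡ (reflexive (≡.cong (ζ ^_) (≡.sym (ℕ.*-identityˡ (toℕ a ℕ.* toℕ z))))))
                    (ζ^[[n∸m]*k]*ζ^[m*k]≈1 (toℕ a ℕ.* toℕ z) (ℕ.>-nonZero⁻¹ n))

  δ₀-0ₙ : ∀ {z} → z ≡ 0ₙ → δ₀ z ≈ 1#
  δ₀-0ₙ {z} z≡0ₙ = helper z (≡.trans (≡.cong toℕ z≡0ₙ) toℕ-0ₙ)
    where
    helper : ∀ z → toℕ z ≡ 0 → δ₀ z ≈ 1#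
    helper z e with toℕ z
    helper z ≡.refl | zero = refl

  δ₀-≢0ₙ : ∀ {z} → z ≢ 0ₙ → δ₀ z ≈ 0#
  δ₀-≢0ₙ {z} z≢0ₙ = helper z (λ e → z≢0ₙ (toℕ-injective (≡.trans e (≡.sym toℕ-0ₙ))))
    where
    helper : ∀ z → toℕ z ≢ 0 → δ₀ z ≈ 0#
    helper z e with toℕ z
    ... | zero = contradiction ≡.refl e
    ... | suc _ = refl

  geometric-sum : ∀ ω m → ω * sum {m} (λ j → ω ^ toℕ j) + 1# ≈ sum {m} (λ j → ω ^ toℕ j) + ω ^ m
  geometric-sum ω zero = +-congʳ (zeroʳ ω)
  geometric-sum ω (suc m) = begin
    ω * (1# + sum {m} (λ j → ω * ω ^ toℕ j)) + 1#   ≈⟨ +-congʳ (*-congˡ (+-congˡ ωG)) ⟨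
    ω * (1# + ω * G) + 1#
      ≈⟨ solve 3 (λ w g o → w :* (o :+ w :* g) :+ o := w :* (w :* g :+ o) :+ o) refl ω G 1# ⟩
    ω * (ω * G + 1#) + 1#                           ≈⟨ +-congʳ (*-congˡ (geometric-sum ω m)) ⟩
    ω * (G + ω ^ m) + 1#
      ≈⟨ solve 4 (λ w g o p → w :* (g :+ p) :+ o := (o :+ w :* g) :+ w :* p) refl ω G 1# (ω ^ m) ⟩
    (1# + ω * G) + ω * ω ^ m                        ≈⟨ +-congʳ (+-congˡ ωG) ⟩
    (1# + sum {m} (λ j → ω * ω ^ toℕ j)) + ω * ω ^ m ∎
    where
    G = sum {m} (λ j → ω ^ toℕ j)
    ωG : ω * G ≈ sum {m} (λ j → ω * ω ^ toℕ j)
    ωG = *-distribˡ-sum {m} ω (λ j → ω ^ toℕ j)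

  χ-orthogonality : ∀ a → sum (λ z → χ z a) ≈ ι n * δ₀ a
  χ-orthogonality a with a F.≟ 0ₙ
  ... | yes ≡.refl = begin
    sum (λ z → χ z 0ₙ)   ≈⟨ sum-cong-≋ χ-0ₙ ⟩
    sum {n} (λ _ → 1#)   ≈⟨ sum-replicate n ⟩
    ι n                  ≈⟨ *-identityʳ (ι n) ⟨
    ι n * 1#             ≈⟨ *-congˡ (δ₀-0ₙ ≡.refl) ⟨
    ι n * δ₀ 0ₙ          ∎
  ... | no a≢0ₙ = begin
    sum (λ z → χ z a)    ≈⟨ sum-cong-≋ {n} (λ z → ^-assocʳ ζ (toℕ a) (toℕ z)) ⟨
    G                    ≈⟨ G≈0 ⟩
    0#                   ≈⟨ zeroʳ (ι n) ⟨
    ι n * 0#             ≈⟨ *-congˡ (δ₀-≢0ₙ a≢0ₙ) ⟨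
    ι n * δ₀ a           ∎
    where
    ω = ζ ^ toℕ a
    G = sum {n} (λ z → ω ^ toℕ z)
    ω^n≈1 : ω ^ n ≈ 1#
    ω^n≈1 = trans (^-assocʳ ζ (toℕ a) n) (ζ^[q*n]≈1 (toℕ a))
    [ω-1]G≈0 : (ω - 1#) * G ≈ 0#
    [ω-1]G≈0 = begin
      (ω - 1#) * G     ≈⟨ [y-z]x≈yx-zx G ω 1# ⟩
      ω * G - 1# * G   ≈⟨ +-cong (∙-cancelʳ 1# _ _ (trans (geometric-sum ω n) (+-congˡ ω^n≈1))) (-‿cong (*-identityˡ G)) ⟩
      G - G            ≈⟨ -‿inverseʳ G ⟩
      0#               ∎
    ω≉1 : ¬ (ω ≈ 1#)
    ω≉1 = proj₂ ζ-primitive (toℕ a) (ℕ.n≢0⇒n>0 (λ e → a≢0ₙ (toℕ-injective (≡.trans e (≡.sym toℕ-0ₙ))))) (toℕ<n a)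
    G≈0 : G ≈ 0#
    G≈0 with dom (ω - 1#) G [ω-1]G≈0
    ... | inj₁ ω-1≈0 = contradiction (x∙y⁻¹≈ε⇒x≈y ω 1# ω-1≈0) ω≉1
    ... | inj₂ G≈0 = G≈0

  𝓕 : (Fin n → ℕ) → Fin n → Carrier
  𝓕 F z = sum (λ m → ι (F m) * χ z m)

  𝓕-cong : ∀ {F G} → (∀ m → F m ≡ G m) → ∀ z → 𝓕 F z ≈ 𝓕 G z
  𝓕-cong F≗G z = sum-cong-≋ {n} (λ m → reflexive (≡.cong (λ k → ι k * χ z m) (F≗G m)))

  𝓕-+ : ∀ F G z → 𝓕 (λ m → F m ℕ.+ G m) z ≈ 𝓕 F z + 𝓕 G z
  𝓕-+ F G z = trans (sum-cong-≋ {n} (λ m → trans (*-congʳ (ι-+ (F m) (G m))) (distribʳ _ _ _))) (∑-distrib-+ {n} _ _)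

  𝓕-* : ∀ k F z → 𝓕 (λ m → k ℕ.* F m) z ≈ ι k * 𝓕 F z
  𝓕-* k F z = trans (sum-cong-≋ {n} (λ m → trans (*-congʳ (ι-* k (F m))) (*-assoc _ _ _))) (sym (*-distribˡ-sum {n} (ι k) _))

  𝓕-combination : ∀ F a G b H z → 𝓕 (λ m → F m ℕ.+ a ℕ.* G m ℕ.+ b ℕ.* H m) z ≈ 𝓕 F z + ι a * 𝓕 G z + ι b * 𝓕 H z
  𝓕-combination F a G b H z = trans (𝓕-+ (λ m → F m ℕ.+ a ℕ.* G m) (λ m → b ℕ.* H m) z)
    (+-cong (trans (𝓕-+ F (λ m → a ℕ.* G m) z) (+-congˡ (𝓕-* a G z))) (𝓕-* b H z))

  𝓕-const : ∀ k z → 𝓕 (λ _ → k) z ≈ ι k * (ι n * δ₀ z)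
  𝓕-const k z = begin
    sum (λ m → ι k * χ z m)      ≈⟨ *-distribˡ-sum (ι k) (χ z) ⟨
    ι k * sum (χ z)              ≈⟨ *-congˡ (sum-cong-≋ {n} (χ-comm z)) ⟩
    ι k * sum (λ m → χ m z)      ≈⟨ *-congˡ (χ-orthogonality z) ⟩
    ι k * (ι n * δ₀ z)           ∎

  𝓕-δ : ∀ i z → 𝓕 (δ _≟ᶠ_ i) z ≈ χ z i
  𝓕-δ i z = ∑-select i (χ z)

  𝓕-sum : ∀ {k} (H : Fin k → Fin n → ℕ) z → 𝓕 (λ m → ℕΣ.sum (λ i → H i m)) z ≈ sum (λ i → 𝓕 (H i) z)
  𝓕-sum H z = begin
    sum (λ m → ι (ℕΣ.sum (λ i → H i m)) * χ z m)
      ≈⟨ sum-cong-≋ {n} (λ m → trans (*-congʳ (ι-sum (λ i → H i m))) (*-distribʳ-sum (χ z m) (λ i → ι (H i m)))) ⟩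
    sum (λ m → sum (λ i → ι (H i m) * χ z m))        ≈⟨ ∑-comm {n} (λ m i → ι (H i m) * χ z m) ⟩
    sum (λ i → 𝓕 (H i) z)                            ∎

  𝓕-translate : ∀ G a z → 𝓕 (λ x → G (-ₙ a +ₙ x)) z ≈ χ z a * 𝓕 G z
  𝓕-translate G a z = begin
    sum (λ x → ι (G (-ₙ a +ₙ x)) * χ z x)                    ≈⟨ ∑-translate a (λ x → ι (G (-ₙ a +ₙ x)) * χ z x) ⟨
    sum (λ m → ι (G (-ₙ a +ₙ (a +ₙ m))) * χ z (a +ₙ m))      ≈⟨ sum-cong-≋ {n} term ⟩
    sum (λ m → χ z a * (ι (G m) * χ z m))                    ≈⟨ *-distribˡ-sum {n} (χ z a) _ ⟨
    χ z a * 𝓕 G z                                            ∎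
    where
    term : ∀ m → ι (G (-ₙ a +ₙ (a +ₙ m))) * χ z (a +ₙ m) ≈ χ z a * (ι (G m) * χ z m)
    term m = begin
      ι (G (-ₙ a +ₙ (a +ₙ m))) * χ z (a +ₙ m)   ≡⟨ ≡.cong (λ k → ι (G k) * χ z (a +ₙ m)) (-ₙ+ₙ-cancelˡ a m) ⟩
      ι (G m) * χ z (a +ₙ m)                    ≈⟨ *-congˡ (χ-+ₙ z a m) ⟩
      ι (G m) * (χ z a * χ z m)                 ≈⟨ x∙yz≈y∙xz (ι (G m)) (χ z a) (χ z m) ⟩
      χ z a * (ι (G m) * χ z m)                 ∎

  𝓕-reflect : ∀ G a z → 𝓕 (λ x → G (a -ₙ x)) z ≈ χ z a * 𝓕 G (-ₙ z)
  𝓕-reflect G a z = begin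
    sum (λ x → ι (G (a -ₙ x)) * χ z x)                       ≈⟨ ∑-reflect a (λ x → ι (G (a -ₙ x)) * χ z x) ⟨
    sum (λ m → ι (G (a -ₙ (a -ₙ m))) * χ z (a -ₙ m))         ≈⟨ sum-cong-≋ {n} term ⟩
    sum (λ m → χ z a * (ι (G m) * χ (-ₙ z) m))               ≈⟨ *-distribˡ-sum {n} (χ z a) _ ⟨
    χ z a * 𝓕 G (-ₙ z)                                       ∎
    where
    term : ∀ m → ι (G (a -ₙ (a -ₙ m))) * χ z (a -ₙ m) ≈ χ z a * (ι (G m) * χ (-ₙ z) m)
    term m = begin
      ι (G (a -ₙ (a -ₙ m))) * χ z (a -ₙ m)      ≡⟨ ≡.cong (λ k → ι (G k) * χ z (a -ₙ m)) (-ₙ-reflection-involutive a m) ⟩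
      ι (G m) * χ z (a -ₙ m)                    ≈⟨ *-congˡ (trans (χ-+ₙ z a (-ₙ m)) (*-congˡ (χ-ₙ z m))) ⟩
      ι (G m) * (χ z a * χ (-ₙ z) m)            ≈⟨ x∙yz≈y∙xz (ι (G m)) (χ z a) (χ (-ₙ z) m) ⟩
      χ z a * (ι (G m) * χ (-ₙ z) m)            ∎

  δ₀-difference : ∀ j m → δ₀ (-ₙ j +ₙ m) ≈ ι (δ _≟ᶠ_ j m)
  δ₀-difference j m with j F.≟ m
  ... | yes ≡.refl = trans (δ₀-0ₙ (-ₙ-inverseˡ j)) (sym ι-1)
  ... | no j≢m = δ₀-≢0ₙ (λ e → j≢m (≡.sym (-ₙa+ₙm≡0ₙ⇒m≡a j m e)))

  𝓕-inversion : ∀ F j → sum (λ z → χ z (-ₙ j) * 𝓕 F z) ≈ ι n * ι (F j)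
  𝓕-inversion F j = begin
    sum (λ z → χ z (-ₙ j) * 𝓕 F z)
      ≈⟨ sum-cong-≋ {n} (λ z → trans (*-distribˡ-sum {n} _ _) (sum-cong-≋ {n} (shift z))) ⟩
    sum (λ z → sum (λ m → ι (F m) * χ z (-ₙ j +ₙ m)))
      ≈⟨ ∑-comm {n} {n} (λ z m → ι (F m) * χ z (-ₙ j +ₙ m)) ⟩
    sum (λ m → sum (λ z → ι (F m) * χ z (-ₙ j +ₙ m)))
      ≈⟨ sum-cong-≋ {n} (λ m → trans (sym (*-distribˡ-sum {n} _ _)) (*-congˡ (χ-orthogonality (-ₙ j +ₙ m)))) ⟩
    sum (λ m → ι (F m) * (ι n * δ₀ (-ₙ j +ₙ m)))
      ≈⟨ sum-cong-≋ {n} (λ m → trans (*-congˡ (*-congˡ (δ₀-difference j m))) (swap (ι (F m)) (ι n) _)) ⟩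
    sum (λ m → ι (δ _≟ᶠ_ j m) * (ι n * ι (F m)))
      ≈⟨ ∑-select j (λ m → ι n * ι (F m)) ⟩
    ι n * ι (F j) ∎
    where
    shift : ∀ z m → χ z (-ₙ j) * (ι (F m) * χ z m) ≈ ι (F m) * χ z (-ₙ j +ₙ m)
    shift z m = trans (x∙yz≈y∙xz _ _ _) (*-congˡ (sym (χ-+ₙ z (-ₙ j) m)))
    swap : ∀ x y d → x * (y * d) ≈ d * (y * x)
    swap = solve 3 (λ x y d → x :* (y :* d) := d :* (y :* x)) refl

  𝓕-injective : CharZero → ∀ F G → (∀ z → 𝓕 F z ≈ 𝓕 G z) → ∀ j → F j ≡ G j
  𝓕-injective ch0 F G 𝓕F≈𝓕G j = ℕ.*-cancelˡ-≡ (F j) (G j) n (ι-injective ch0 (begin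
    ι (n ℕ.* F j)                     ≈⟨ ι-* n (F j) ⟩
    ι n * ι (F j)                     ≈⟨ 𝓕-inversion F j ⟨
    sum (λ z → χ z (-ₙ j) * 𝓕 F z)    ≈⟨ sum-cong-≋ {n} (λ z → *-congˡ (𝓕F≈𝓕G z)) ⟩
    sum (λ z → χ z (-ₙ j) * 𝓕 G z)    ≈⟨ 𝓕-inversion G j ⟩
    ι n * ι (G j)                     ≈⟨ ι-* n (G j) ⟨
    ι (n ℕ.* G j)                     ∎))

  indicator : Subset n → Fin n → ℕ
  indicator V m = if lookup V m then 1 else 0

  charSum≈𝓕 : ∀ V z → charSum ζ V z ≈ 𝓕 (indicator V) z
  charSum≈𝓕 V z = trans (reflexive (foldr-tabulate {m = n} (λ m → m) (λ m → if lookup V m then χ z m else 0#)))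
                        (sum-cong-≋ {n} (λ m → if-then-0≈ι-indicator (lookup V m) _))

  charSumConj≈𝓕 : ∀ V z → charSumConj ζ V z ≈ 𝓕 (indicator V) (-ₙ z)
  charSumConj≈𝓕 V z =
    trans (reflexive (foldr-tabulate {m = n} (λ m → m) (λ m → if lookup V m then ζ ^ ((n ∸ 1) ℕ.* (toℕ m ℕ.* toℕ z)) else 0#)))
          (sum-cong-≋ {n} (λ m → trans (if-then-0≈ι-indicator (lookup V m) _) (*-congˡ (ζ^[[n∸1]*[a*z]]≈χ[-z]a z m))))

  χ-δ₀ : ∀ z a → χ z a * δ₀ z ≈ δ₀ z
  χ-δ₀ z a with z F.≟ 0ₙ
  ... | yes ≡.refl = trans (*-congʳ (trans (χ-comm 0ₙ a) (χ-0ₙ a))) (*-identityˡ _)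
  ... | no z≢0ₙ = trans (*-congˡ (δ₀-≢0ₙ z≢0ₙ)) (trans (zeroʳ _) (sym (δ₀-≢0ₙ z≢0ₙ)))

  δ₀-ₙ : ∀ z → δ₀ (-ₙ z) ≈ δ₀ z
  δ₀-ₙ z with z F.≟ 0ₙ
  ... | yes ≡.refl = reflexive (≡.cong δ₀ -ₙ-0ₙ)
  ... | no z≢0ₙ = trans (δ₀-≢0ₙ -z≢0ₙ) (sym (δ₀-≢0ₙ z≢0ₙ))
    where
    -z≢0ₙ : -ₙ z ≢ 0ₙ
    -z≢0ₙ e = z≢0ₙ (≡.trans (≡.sym (-ₙ-involutive z)) (≡.trans (≡.cong -ₙ_ e) -ₙ-0ₙ))

module _ where
  open import Data.Integer using (+_)

  square-rearrange : ∀ C t d l a m →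
    (C ≡ t ℤ.* d ℤ.+ l ℤ.* a ℤ.+ m ℤ.* (+ 1 ℤ.- d ℤ.- a))
    ⇔ (C ℤ.+ m ℤ.* d ℤ.+ m ℤ.* a ≡ m ℤ.+ t ℤ.* d ℤ.+ l ℤ.* a)
  square-rearrange C t d l a m = mk⇔
    (λ e → ≡.trans (≡.cong (λ x → x ℤ.+ m ℤ.* d ℤ.+ m ℤ.* a) e) (add-back t d l a m))
    (λ e → ≡.trans (take-off C m d a) (≡.trans (≡.cong (λ x → x ℤ.- m ℤ.* d ℤ.- m ℤ.* a) e) (regroup t d l a m)))
    where
    add-back : ∀ t d l a m → t ℤ.* d ℤ.+ l ℤ.* a ℤ.+ m ℤ.* (+ 1 ℤ.- d ℤ.- a) ℤ.+ m ℤ.* d ℤ.+ m ℤ.* a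
                             ≡ m ℤ.+ t ℤ.* d ℤ.+ l ℤ.* a
    add-back = solve-∀
    take-off : ∀ C m d a → C ≡ C ℤ.+ m ℤ.* d ℤ.+ m ℤ.* a ℤ.- m ℤ.* d ℤ.- m ℤ.* a
    take-off = solve-∀
    regroup : ∀ t d l a m → m ℤ.+ t ℤ.* d ℤ.+ l ℤ.* a ℤ.- m ℤ.* d ℤ.- m ℤ.* a
                            ≡ t ℤ.* d ℤ.+ l ℤ.* a ℤ.+ m ℤ.* (+ 1 ℤ.- d ℤ.- a)
    regroup = solve-∀

  pos-[x+y*z+w*v] : ∀ x y z w v → + (x ℕ.+ y ℕ.* z ℕ.+ w ℕ.* v) ≡ + x ℤ.+ + y ℤ.* + z ℤ.+ + w ℤ.* + v
  pos-[x+y*z+w*v] x y z w v = ≡.trans (ℤ.pos-+ (x ℕ.+ y ℕ.* z) (w ℕ.* v))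
    (≡.cong₂ ℤ._+_ (≡.trans (ℤ.pos-+ x (y ℕ.* z)) (≡.cong (λ p → + x ℤ.+ p) (ℤ.pos-* y z))) (ℤ.pos-* w v))

  ℕ-square⇔ : ∀ C t d l a m →
    (+ C ≡ + t ℤ.* + d ℤ.+ + l ℤ.* + a ℤ.+ + m ℤ.* (+ 1 ℤ.- + d ℤ.- + a))
    ⇔ (C ℕ.+ m ℕ.* d ℕ.+ m ℕ.* a ≡ m ℕ.+ t ℕ.* d ℕ.+ l ℕ.* a)
  ℕ-square⇔ C t d l a m = ⇔-trans (square-rearrange (+ C) (+ t) (+ d) (+ l) (+ a) (+ m)) (mk⇔
    (λ e → ℤ.+-injective (≡.trans (pos-[x+y*z+w*v] C m d m a) (≡.trans e (≡.sym (pos-[x+y*z+w*v] m t d l a)))))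
    (λ e → ≡.trans (≡.sym (pos-[x+y*z+w*v] C m d m a)) (≡.trans (≡.cong +_ e) (pos-[x+y*z+w*v] m t d l a))))

module _ {A : Set} where

  pairs : List A → List (A × Bool)
  pairs = concatMap (λ a → (a , false) ∷ (a , true) ∷ [])

  sumℕ-pairs-tabulate : ∀ {m} (g : Fin m → A) (f : A × Bool → ℕ) →
    sumℕ (pairs (tabulate g)) f ≡ ℕΣ.sum (λ k → f (g k , false) ℕ.+ f (g k , true))
  sumℕ-pairs-tabulate {zero} g f = ≡.refl
  sumℕ-pairs-tabulate {suc m} g f = ≡.trans (≡.sym (ℕ.+-assoc (f (g F.zero , false)) _ _))
    (≡.cong (_ ℕ.+_) (sumℕ-pairs-tabulate (λ k → g (F.suc k)) f))

  length-pairs-tabulate : ∀ {m} (g : Fin m → A) → length (pairs (tabulate g)) ≡ 2 ℕ.* m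
  length-pairs-tabulate {zero} g = ≡.refl
  length-pairs-tabulate {suc m} g =
    ≡.trans (≡.cong (λ k → suc (suc k)) (length-pairs-tabulate (λ k → g (F.suc k)))) (≡.sym (ℕ.*-suc 2 m))

∣p∣≡sum-indicator : ∀ {k} (p : Subset k) → ∣ p ∣ ≡ ℕΣ.sum (λ i → if lookup p i then 1 else 0)
∣p∣≡sum-indicator [] = ≡.refl
∣p∣≡sum-indicator (true ∷ p) = ≡.cong suc (∣p∣≡sum-indicator p)
∣p∣≡sum-indicator (false ∷ p) = ∣p∣≡sum-indicator p

module DihedralCayley (n : ℕ) .{{_ : NonZero n}} (X Y : Subset n) where
  open ℤₙ n
  open ℤₙ-Sums ℕ.+-0-commutativeMonoid n

  A : Dih n → Dih n → ℕ
  A = dihAdj n X Y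

  A² : Dih n → Dih n → ℕ
  A² g h = sumℕ (dihElems n) (λ w → A g w ℕ.* A w h)

  S : Bool → Fin n → ℕ
  S d m = inConn n X Y (m , d)

  sumℕ-dihElems : ∀ f → sumℕ (dihElems n) f ≡ ℕΣ.sum (λ k → f (k , false) ℕ.+ f (k , true))
  sumℕ-dihElems = sumℕ-pairs-tabulate (λ m → m)

  ∑S+∑S-swap : ∀ d → ℕΣ.sum (S d) ℕ.+ ℕΣ.sum (S (d xor true)) ≡ ∣ X ∣ ℕ.+ ∣ Y ∣
  ∑S+∑S-swap false = ≡.sym (≡.cong₂ ℕ._+_ (∣p∣≡sum-indicator X) (∣p∣≡sum-indicator Y))
  ∑S+∑S-swap true = ≡.trans (ℕ.+-comm (ℕΣ.sum (S true)) (ℕΣ.sum (S false))) (∑S+∑S-swap false)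

  sumℕ-dihElems-S : ∀ f d → ℕΣ.sum (λ k → f (k , false)) ≡ ℕΣ.sum (S d) →
                    ℕΣ.sum (λ k → f (k , true)) ≡ ℕΣ.sum (S (d xor true)) →
                    sumℕ (dihElems n) f ≡ ∣ X ∣ ℕ.+ ∣ Y ∣
  sumℕ-dihElems-S f d e₁ e₂ = begin
    sumℕ (dihElems n) f                                                 ≡⟨ sumℕ-dihElems f ⟩
    ℕΣ.sum (λ k → f (k , false) ℕ.+ f (k , true))                       ≡⟨ ℕΣ.∑-distrib-+ {n} (λ k → f (k , false)) _ ⟩
    ℕΣ.sum (λ k → f (k , false)) ℕ.+ ℕΣ.sum (λ k → f (k , true))        ≡⟨ ≡.cong₂ ℕ._+_ e₁ e₂ ⟩
    ℕΣ.sum (S d) ℕ.+ ℕΣ.sum (S (d xor true))                            ≡⟨ ∑S+∑S-swap d ⟩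
    ∣ X ∣ ℕ.+ ∣ Y ∣                                                     ∎
    where open ≡.≡-Reasoning

  rowSum : ∀ g → sumℕ (dihElems n) (A g) ≡ ∣ X ∣ ℕ.+ ∣ Y ∣
  rowSum (i , false) = sumℕ-dihElems-S (A (i , false)) false (∑-translate (-ₙ i) (S false)) (∑-translate (-ₙ i) (S true))
  rowSum (i , true) = sumℕ-dihElems-S (A (i , true)) true (∑-reflect i (S true)) (∑-reflect i (S false))

  colSum : ∀ h → sumℕ (dihElems n) (λ g → A g h) ≡ ∣ X ∣ ℕ.+ ∣ Y ∣
  colSum (j , c) = sumℕ-dihElems-S (λ g → A g (j , c)) c
    (≡.trans (ℕΣ.sum-cong-≗ (λ k → ≡.cong (S c) (+ₙ-comm (-ₙ k) j))) (∑-reflect j (S c)))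
    (≡.trans (ℕΣ.sum-cong-≗ (λ k → ≡.cong (S (c xor true)) (+ₙ-comm k (-ₙ j)))) (∑-translate (-ₙ j) (S (c xor true))))

_≟ᴮ_ : Bool → Bool → Bool
b ≟ᴮ c = does (b 𝔹.≟ c)

δ-∧ : ∀ {A B : Set} (eqA : A → A → Bool) (eqB : B → B → Bool) a a′ b b′ →
      (if eqA a a′ ∧ eqB b b′ then 1 else 0) ≡ δ eqA a a′ ℕ.* δ eqB b b′
δ-∧ eqA eqB a a′ b b′ with eqA a a′
... | true = ≡.sym (ℕ.+-identityʳ _)
... | false = ≡.refl

module DihedralSpectrum {c ℓ} (R : CommutativeRing c ℓ) (dom : Cyclo.IsIntegralDomain R)
                        (n : ℕ) .{{_ : NonZero n}}
                        (ζ : CommutativeRing.Carrier R) (ζ-primitive : Cyclo.IsPrimitiveRoot R n ζ)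
                        (X Y : Subset n) (μ lam t : ℕ) where
  open CommutativeRing R
  open Cyclo R using (ι; δ₀; CharZero; charSum; charSumConj)
  open import Algebra.Properties.Semiring.Sum semiring using (sum; ∑-distrib-+; *-distribʳ-sum; sum-cong-≋)
  open import Algebra.Solver.Ring.NaturalCoefficients.Default commutativeSemiring
    using (solve; _:*_; _:+_; _:=_; con)
  open import Relation.Binary.Reasoning.Setoid setoid
  open RingProperties R
  open ℤₙ n
  open Fourier R dom n ζ ζ-primitive
  open DihedralCayley n X Y

  -- M · · z is the transform of the adjacency matrix at z: the 2×2 block matrix
  -- [[𝐫(z), 𝐭(z)], [𝐭(-z), 𝐫(-z)]] with rows and columns indexed by a^0, a^1.
  M : Bool → Bool → Fin n → Carrier
  M false d z = 𝓕 (S d) z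
  M true d z = 𝓕 (S (d xor true)) (-ₙ z)

  𝓕-row : ∀ i b d z → 𝓕 (λ k → A (i , b) (k , d)) z ≈ χ z i * M b d z
  𝓕-row i false d z = 𝓕-translate (S d) i z
  𝓕-row i true d z = 𝓕-reflect (S (d xor true)) i z

  𝓕-A² : ∀ g c z → 𝓕 (λ j → A² g (j , c)) z
                   ≈ 𝓕 (λ k → A g (k , false)) z * M false c z + 𝓕 (λ k → A g (k , true)) z * M true c z
  𝓕-A² g c z = begin
    𝓕 (λ j → A² g (j , c)) z                                    ≈⟨ 𝓕-cong (λ j → sumℕ-dihElems (λ w → A g w ℕ.* A w (j , c))) z ⟩
    𝓕 (λ j → ℕΣ.sum (λ k → path k false j ℕ.+ path k true j)) z  ≈⟨ 𝓕-sum (λ k j → path k false j ℕ.+ path k true j) z ⟩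
    sum (λ k → 𝓕 (λ j → path k false j ℕ.+ path k true j) z)    ≈⟨ sum-cong-≋ {n} through ⟩
    sum (λ k → term false k + term true k)                      ≈⟨ ∑-distrib-+ {n} (term false) (term true) ⟩
    sum (term false) + sum (term true)                          ≈⟨ +-cong (*-distribʳ-sum _ (weight false)) (*-distribʳ-sum _ (weight true)) ⟨
    𝓕 (λ k → A g (k , false)) z * M false c z + 𝓕 (λ k → A g (k , true)) z * M true c z ∎
    where
    path : Fin n → Bool → Fin n → ℕ
    path k d j = A g (k , d) ℕ.* A (k , d) (j , c)
    weight term : Bool → Fin n → Carrier
    weight d k = ι (A g (k , d)) * χ z k
    term d k = weight d k * M d c z
    via : ∀ k d → 𝓕 (path k d) z ≈ term d k
    via k d = trans (𝓕-* (A g (k , d)) (λ j → A (k , d) (j , c)) z) (trans (*-congˡ (𝓕-row k d c z)) (sym (*-assoc _ _ _)))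
    through : ∀ k → 𝓕 (λ j → path k false j ℕ.+ path k true j) z ≈ term false k + term true k
    through k = trans (𝓕-+ (path k false) (path k true) z) (+-cong (via k false) (via k true))

  squareLHS squareRHS : Dih n → Dih n → ℕ
  squareLHS g h = A² g h ℕ.+ μ ℕ.* δ (eqDih n) g h ℕ.+ μ ℕ.* A g h
  squareRHS g h = μ ℕ.+ t ℕ.* δ (eqDih n) g h ℕ.+ lam ℕ.* A g h

  spectralLHS spectralRHS : Bool → Bool → Fin n → Carrier
  spectralLHS b c z = M b false z * M false c z + M b true z * M true c z + ι μ * ι (δ _≟ᴮ_ b c) + ι μ * M b c z
  spectralRHS b c z = ι μ * ι n * δ₀ z + ι t * ι (δ _≟ᴮ_ b c) + ι lam * M b c z

  𝓕-δ-eqDih : ∀ i b c z → 𝓕 (λ j → δ (eqDih n) (i , b) (j , c)) z ≈ ι (δ _≟ᴮ_ b c) * χ z i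
  𝓕-δ-eqDih i b c z = begin
    𝓕 (λ j → δ (eqDih n) (i , b) (j , c)) z     ≈⟨ 𝓕-cong split z ⟩
    𝓕 (λ j → δ _≟ᴮ_ b c ℕ.* δ _≟ᶠ_ i j) z       ≈⟨ 𝓕-* (δ _≟ᴮ_ b c) (δ _≟ᶠ_ i) z ⟩
    ι (δ _≟ᴮ_ b c) * 𝓕 (δ _≟ᶠ_ i) z             ≈⟨ *-congˡ (𝓕-δ i z) ⟩
    ι (δ _≟ᴮ_ b c) * χ z i                      ∎
    where
    split : ∀ j → δ (eqDih n) (i , b) (j , c) ≡ δ _≟ᴮ_ b c ℕ.* δ _≟ᶠ_ i j
    split j = ≡.trans (δ-∧ _≟ᶠ_ _≟ᴮ_ i j b c) (ℕ.*-comm (δ _≟ᶠ_ i j) _)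

  𝓕-squareLHS : ∀ i b c z → 𝓕 (λ j → squareLHS (i , b) (j , c)) z ≈ χ z i * spectralLHS b c z
  𝓕-squareLHS i b c z = begin
    𝓕 (λ j → squareLHS (i , b) (j , c)) z
      ≈⟨ 𝓕-combination (λ j → A² (i , b) (j , c)) μ (λ j → δ (eqDih n) (i , b) (j , c)) μ (λ j → A (i , b) (j , c)) z ⟩
    𝓕 (λ j → A² (i , b) (j , c)) z + ι μ * 𝓕 (λ j → δ (eqDih n) (i , b) (j , c)) z + ι μ * 𝓕 (λ j → A (i , b) (j , c)) z
      ≈⟨ +-cong (+-cong (𝓕-A² (i , b) c z) (*-congˡ (𝓕-δ-eqDih i b c z))) (*-congˡ (𝓕-row i b c z)) ⟩
    𝓕 (λ k → A (i , b) (k , false)) z * M false c z + 𝓕 (λ k → A (i , b) (k , true)) z * M true c z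
      + ι μ * (ι (δ _≟ᴮ_ b c) * χ z i) + ι μ * (χ z i * M b c z)
      ≈⟨ +-congʳ (+-congʳ (+-cong (*-congʳ (𝓕-row i b false z)) (*-congʳ (𝓕-row i b true z)))) ⟩
    χ z i * M b false z * M false c z + χ z i * M b true z * M true c z
      + ι μ * (ι (δ _≟ᴮ_ b c) * χ z i) + ι μ * (χ z i * M b c z)
      ≈⟨ solve 8 (λ x p q r s u e m →
           x :* p :* q :+ x :* r :* s :+ u :* (e :* x) :+ u :* (x :* m)
           := x :* (p :* q :+ r :* s :+ u :* e :+ u :* m))
         refl (χ z i) (M b false z) (M false c z) (M b true z) (M true c z) (ι μ) (ι (δ _≟ᴮ_ b c)) (M b c z) ⟩
    χ z i * spectralLHS b c z ∎

  𝓕-squareRHS : ∀ i b c z → 𝓕 (λ j → squareRHS (i , b) (j , c)) z ≈ χ z i * spectralRHS b c z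
  𝓕-squareRHS i b c z = begin
    𝓕 (λ j → squareRHS (i , b) (j , c)) z
      ≈⟨ 𝓕-combination (λ _ → μ) t (λ j → δ (eqDih n) (i , b) (j , c)) lam (λ j → A (i , b) (j , c)) z ⟩
    𝓕 (λ _ → μ) z + ι t * 𝓕 (λ j → δ (eqDih n) (i , b) (j , c)) z + ι lam * 𝓕 (λ j → A (i , b) (j , c)) z
      ≈⟨ +-cong (+-cong (trans (𝓕-const μ z) (*-congˡ (*-congˡ (sym (χ-δ₀ z i)))))
                        (*-congˡ (𝓕-δ-eqDih i b c z)))
                (*-congˡ (𝓕-row i b c z)) ⟩
    ι μ * (ι n * (χ z i * δ₀ z)) + ι t * (ι (δ _≟ᴮ_ b c) * χ z i) + ι lam * (χ z i * M b c z)
      ≈⟨ solve 8 (λ x U N d T e L m →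
           U :* (N :* (x :* d)) :+ T :* (e :* x) :+ L :* (x :* m)
           := x :* (U :* N :* d :+ T :* e :+ L :* m))
         refl (χ z i) (ι μ) (ι n) (δ₀ z) (ι t) (ι (δ _≟ᴮ_ b c)) (ι lam) (M b c z) ⟩
    χ z i * spectralRHS b c z ∎

  -- Conjugating by the reflection a exchanges the two cosets and replaces z by -z.
  M-swap : ∀ b d z → M b d z ≈ M (not b) (not d) (-ₙ z)
  M-swap false false z = reflexive (≡.cong (𝓕 (S false)) (≡.sym (-ₙ-involutive z)))
  M-swap false true z = reflexive (≡.cong (𝓕 (S true)) (≡.sym (-ₙ-involutive z)))
  M-swap true false z = refl
  M-swap true true z = refl

  δ-≟ᴮ-not : ∀ b c → δ _≟ᴮ_ b c ≡ δ _≟ᴮ_ (not b) (not c)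
  δ-≟ᴮ-not false false = ≡.refl
  δ-≟ᴮ-not false true = ≡.refl
  δ-≟ᴮ-not true false = ≡.refl
  δ-≟ᴮ-not true true = ≡.refl

  spectralLHS-swap : ∀ b c z → spectralLHS b c z ≈ spectralLHS (not b) (not c) (-ₙ z)
  spectralLHS-swap b c z =
    +-cong (+-cong products (*-congˡ (reflexive (≡.cong ι (δ-≟ᴮ-not b c))))) (*-congˡ (M-swap b c z))
    where
    products : M b false z * M false c z + M b true z * M true c z
               ≈ M (not b) false (-ₙ z) * M false (not c) (-ₙ z) + M (not b) true (-ₙ z) * M true (not c) (-ₙ z)
    products = trans (+-cong (*-cong (M-swap b false z) (M-swap false c z)) (*-cong (M-swap b true z) (M-swap true c z)))
                     (+-comm _ _)

  spectralRHS-swap : ∀ b c z → spectralRHS b c z ≈ spectralRHS (not b) (not c) (-ₙ z)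
  spectralRHS-swap b c z =
    +-cong (+-cong (*-congˡ (sym (δ₀-ₙ z))) (*-congˡ (reflexive (≡.cong ι (δ-≟ᴮ-not b c))))) (*-congˡ (M-swap b c z))

  SquareIdentities : Set
  SquareIdentities = ∀ g h → squareLHS g h ≡ squareRHS g h

  SpectralIdentities : Set ℓ
  SpectralIdentities = ∀ c z → spectralLHS false c z ≈ spectralRHS false c z

  spectral-all-rows : SpectralIdentities → ∀ b c z → spectralLHS b c z ≈ spectralRHS b c z
  spectral-all-rows E false c z = E c z
  spectral-all-rows E true c z = begin
    spectralLHS true c z                 ≈⟨ spectralLHS-swap true c z ⟩
    spectralLHS false (not c) (-ₙ z)     ≈⟨ E (not c) (-ₙ z) ⟩
    spectralRHS false (not c) (-ₙ z)     ≈⟨ spectralRHS-swap true c z ⟨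
    spectralRHS true c z                 ∎

  square⇔spectral : CharZero → SquareIdentities ⇔ SpectralIdentities
  square⇔spectral ch0 = mk⇔ at-identity everywhere
    where
    at-identity : SquareIdentities → SpectralIdentities
    at-identity E c z = begin
      spectralLHS false c z                              ≈⟨ *-identityˡ _ ⟨
      1# * spectralLHS false c z                         ≈⟨ *-congʳ (χ-0ₙ z) ⟨
      χ z 0ₙ * spectralLHS false c z                     ≈⟨ 𝓕-squareLHS 0ₙ false c z ⟨
      𝓕 (λ j → squareLHS (0ₙ , false) (j , c)) z         ≈⟨ 𝓕-cong (λ j → E (0ₙ , false) (j , c)) z ⟩
      𝓕 (λ j → squareRHS (0ₙ , false) (j , c)) z         ≈⟨ 𝓕-squareRHS 0ₙ false c z ⟩
      χ z 0ₙ * spectralRHS false c z                     ≈⟨ *-congʳ (χ-0ₙ z) ⟩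
      1# * spectralRHS false c z                         ≈⟨ *-identityˡ _ ⟩
      spectralRHS false c z                              ∎
    everywhere : SpectralIdentities → SquareIdentities
    everywhere E (i , b) (j , c) =
      𝓕-injective ch0 (λ j → squareLHS (i , b) (j , c)) (λ j → squareRHS (i , b) (j , c)) (λ z → begin
        𝓕 (λ j → squareLHS (i , b) (j , c)) z    ≈⟨ 𝓕-squareLHS i b c z ⟩
        χ z i * spectralLHS b c z                ≈⟨ *-congˡ (spectral-all-rows E b c z) ⟩
        χ z i * spectralRHS b c z                ≈⟨ 𝓕-squareRHS i b c z ⟨
        𝓕 (λ j → squareRHS (i , b) (j , c)) z    ∎) j

  isDSRG⇔spectral : CharZero → IsDSRG (dihElems n) (eqDih n) A (2 ℕ.* n) (∣ X ∣ ℕ.+ ∣ Y ∣) μ lam t ⇔ SpectralIdentities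
  isDSRG⇔spectral ch0 = mk⇔
    (λ D → Equivalence.to (square⇔spectral ch0) (λ g h → Equivalence.to (square⇔ g h) (IsDSRG.square D g h)))
    (λ E → record
      { vertexCount = length-pairs-tabulate {m = n} (λ m → m)
      ; rowSums = rowSum
      ; colSums = colSum
      ; square = λ g h → Equivalence.from (square⇔ g h) (Equivalence.from (square⇔spectral ch0) E g h)
      })
    where
    square⇔ : ∀ g h → _ ⇔ (squareLHS g h ≡ squareRHS g h)
    square⇔ g h = ℕ-square⇔ (A² g h) t (δ (eqDih n) g h) lam (A g h) μ

  𝐫 𝐫̄ 𝐭 𝐭̄ : Fin n → Carrier
  𝐫 = charSum ζ X
  𝐫̄ = charSumConj ζ X
  𝐭 = charSum ζ Y
  𝐭̄ = charSumConj ζ Y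

  spectral-false-true⇔ : ∀ z → (spectralLHS false true z ≈ spectralRHS false true z)
                             ⇔ (𝐭 z * (𝐫 z + 𝐫̄ z) ≈ ι μ * ι n * δ₀ z + (ι lam - ι μ) * 𝐭 z)
  spectral-false-true⇔ z = +-cancelʳ-⇔ lhs rhs
    where
    r = charSum≈𝓕 X z
    r̄ = charSumConj≈𝓕 X z
    tt = charSum≈𝓕 Y z
    lhs : spectralLHS false true z ≈ 𝐭 z * (𝐫 z + 𝐫̄ z) + ι μ * 𝐭 z
    lhs = begin
      spectralLHS false true z
        ≈⟨ +-cong (+-congʳ (+-cong (*-cong r tt) (*-cong tt r̄))) (*-congˡ tt) ⟨
      𝐫 z * 𝐭 z + 𝐭 z * 𝐫̄ z + ι μ * 0# + ι μ * 𝐭 z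
        ≈⟨ solve 4 (λ r t r̄ u → r :* t :+ t :* r̄ :+ u :* con 0 :+ u :* t := t :* (r :+ r̄) :+ u :* t)
                   refl (𝐫 z) (𝐭 z) (𝐫̄ z) (ι μ) ⟩
      𝐭 z * (𝐫 z + 𝐫̄ z) + ι μ * 𝐭 z ∎
    rhs : spectralRHS false true z ≈ ι μ * ι n * δ₀ z + (ι lam - ι μ) * 𝐭 z + ι μ * 𝐭 z
    rhs = begin
      spectralRHS false true z                                ≈⟨ +-cong (+-congˡ (sym (zeroʳ (ι t)))) (*-congˡ tt) ⟨
      ι μ * ι n * δ₀ z + 0# + ι lam * 𝐭 z                     ≈⟨ +-congʳ (+-identityʳ _) ⟩
      ι μ * ι n * δ₀ z + ι lam * 𝐭 z                          ≈⟨ +-congˡ ([a-b]x+bx≈ax (ι lam) (ι μ) (𝐭 z)) ⟨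
      ι μ * ι n * δ₀ z + ((ι lam - ι μ) * 𝐭 z + ι μ * 𝐭 z)    ≈⟨ +-assoc _ _ _ ⟨
      ι μ * ι n * δ₀ z + (ι lam - ι μ) * 𝐭 z + ι μ * 𝐭 z      ∎

  spectral-false-false⇔ : ∀ z → (spectralLHS false false z ≈ spectralRHS false false z)
                              ⇔ (𝐫 z * 𝐫 z + 𝐭 z * 𝐭̄ z ≈ ι t - ι μ + ι μ * ι n * δ₀ z + (ι lam - ι μ) * 𝐫 z)
  spectral-false-false⇔ z = +-cancelʳ-⇔ lhs rhs
    where
    r = charSum≈𝓕 X z
    tt = charSum≈𝓕 Y z
    t̄ = charSumConj≈𝓕 Y z
    U = ι μ
    D = U * ι n * δ₀ z
    lhs : spectralLHS false false z ≈ 𝐫 z * 𝐫 z + 𝐭 z * 𝐭̄ z + (U + U * 𝐫 z)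
    lhs = begin
      spectralLHS false false z
        ≈⟨ +-cong (+-cong (+-cong (*-cong r r) (*-cong tt t̄)) (*-congˡ (sym ι-1))) (*-congˡ r) ⟨
      𝐫 z * 𝐫 z + 𝐭 z * 𝐭̄ z + U * 1# + U * 𝐫 z   ≈⟨ +-congʳ (+-congˡ (*-identityʳ U)) ⟩
      𝐫 z * 𝐫 z + 𝐭 z * 𝐭̄ z + U + U * 𝐫 z        ≈⟨ +-assoc _ _ _ ⟩
      𝐫 z * 𝐫 z + 𝐭 z * 𝐭̄ z + (U + U * 𝐫 z)      ∎
    rhs : spectralRHS false false z ≈ ι t - U + D + (ι lam - U) * 𝐫 z + (U + U * 𝐫 z)
    rhs = begin
      spectralRHS false false z                  ≈⟨ +-cong (+-congˡ (*-congˡ (sym ι-1))) (*-congˡ r) ⟨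
      D + ι t * 1# + ι lam * 𝐫 z                 ≈⟨ +-congʳ (+-congˡ (*-identityʳ (ι t))) ⟩
      D + ι t + ι lam * 𝐫 z                      ≈⟨ +-cong (+-congˡ (+-identityʳ _)) (+-identityʳ _) ⟨
      D + (ι t + 0#) + (ι lam * 𝐫 z + 0#)
        ≈⟨ +-cong (+-congˡ (+-congˡ (-‿inverseˡ U))) (+-congˡ (trans (*-congʳ (-‿inverseˡ U)) (zeroˡ (𝐫 z)))) ⟨
      D + (ι t + (- U + U)) + (ι lam * 𝐫 z + (- U + U) * 𝐫 z)
        ≈⟨ solve 6 (λ T m D L x u → D :+ (T :+ (m :+ u)) :+ (L :* x :+ (m :+ u) :* x)
                                    := T :+ m :+ D :+ (L :+ m) :* x :+ (u :+ u :* x))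
                   refl (ι t) (- U) D (ι lam) (𝐫 z) U ⟩
      ι t - U + D + (ι lam - U) * 𝐫 z + (U + U * 𝐫 z) ∎

  spectral⇔conditions : SpectralIdentities
    ⇔ (∀ z → (𝐭 z * (𝐫 z + 𝐫̄ z) ≈ ι μ * ι n * δ₀ z + (ι lam - ι μ) * 𝐭 z)
             × (𝐫 z * 𝐫 z + 𝐭 z * 𝐭̄ z ≈ ι t - ι μ + ι μ * ι n * δ₀ z + (ι lam - ι μ) * 𝐫 z))
  spectral⇔conditions = mk⇔
    (λ E z → Equivalence.to (spectral-false-true⇔ z) (E true z) , Equivalence.to (spectral-false-false⇔ z) (E false z))
    from
    where
    from : _ → SpectralIdentities
    from C false z = Equivalence.from (spectral-false-false⇔ z) (proj₂ (C z))
    from C true z = Equivalence.from (spectral-false-true⇔ z) (proj₁ (C z))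

lemma4p3 : {c ℓ : Level} (R : CommutativeRing c ℓ) →
  Cyclo.IsIntegralDomain R → Cyclo.CharZero R →
  (n : ℕ) .{{_ : NonZero n}} →
  (ζ : CommutativeRing.Carrier R) → Cyclo.IsPrimitiveRoot R n ζ →
  (X Y : Subset n) → (∀ i → lookup X i ≡ true → toℕ i ≢ 0) →
  (μ lam t : ℕ) →
  let open CommutativeRing R
      open Cyclo R
      𝐫 = charSum ζ X
      𝐫̄ = charSumConj ζ X
      𝐭 = charSum ζ Y
      𝐭̄ = charSumConj ζ Y
  in IsDSRG (dihElems n) (eqDih n) (dihAdj n X Y) (2 ℕ.* n) (∣ X ∣ ℕ.+ ∣ Y ∣) μ lam t
     ⇔ (∀ (z : Fin n) →
          (𝐭 z * (𝐫 z + 𝐫̄ z)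
             ≈ ι μ * ι n * δ₀ z + (ι lam - ι μ) * 𝐭 z)
        × (𝐫 z * 𝐫 z + 𝐭 z * 𝐭̄ z
             ≈ ι t - ι μ + ι μ * ι n * δ₀ z + (ι lam - ι μ) * 𝐫 z))
lemma4p3 R dom ch0 n ζ ζ-primitive X Y _ μ lam t =
  ⇔-trans (isDSRG⇔spectral ch0) spectral⇔conditions
  where open DihedralSpectrum R dom n ζ ζ-primitive X Y μ lam t
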